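{- Let $q$ be a prime power and let $G=G(q)$ be the bipartite point–line incidence graph defined below. Suppose $p_1\ell_1p_2\ell_2p_3\ell_3p_4\ell_4p_1$ is a cycle of length $8$ in $G$ (with $p_i\in P$, $\ell_i\in L$), and let $v_1,v_2,v_3,v_4$ be the directions of the lines $\ell_1,\ell_2,\ell_3,\ell_4$ respectively. Then $v_1=v_3$, $v_2=v_4$, and $v_1\neq v_2$.
   Context: Let $\mathbb F_q$ be the finite field with $q$ elements. For $z\in\mathbb F_q$ let $v_z=(1,z,z^2,z^3)\in\mathbb F_q^4$. For each $z$, let $\mathcal L_z$ be the set of all lines $\{x+yv_z: y\in\mathbb F_q\}$ with $x\in\mathbb F_q^4$ (so $|\mathcal L_z|=q^3$); a line in $\mathcal L_z$ is said to have direction $v_z$. Let $P=\mathbb F_q^4$ and $L=\bigcup_{z\in\mathbb F_q}\mathcal L_z$. $G(q)$ is the bipartite graph with parts $P$ and $L$ in which $p\in P$ and $\ell\in L$ are adjacent if and only if $p\in\ell$. -}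

module Defs where

open import Data.Nat using (ℕ; suc; _^_)
open import Data.Nat.Primality using (Prime)
open import Data.Fin using (Fin)
open import Data.Product using (Σ; ∃; _×_; _,_)
open import Data.Vec using (Vec; []; _∷_; zipWith; map)
open import Function.Bundles using (_↔_)
open import Relation.Binary.PropositionalEquality using (_≡_; _≢_)
open import Relation.Nullary using (¬_)
open import Algebra.Structures using (IsCommutativeRing)

IsPrimePower : ℕ → Set
IsPrimePower q = ∃ λ p → ∃ λ k → Prime p × q ≡ p ^ suc k

record Field : Set₁ where
  infixl 6 _+_
  infixl 7 _*_
  field
    Carrier : Set
    _+_ _*_ : Carrier → Carrier → Carrier
    -_      : Carrier → Carrier
    0# 1#   : Carrier
    isCommutativeRing : IsCommutativeRing _≡_ _+_ _*_ -_ 0# 1#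
    0≢1     : 0# ≢ 1#
    inverse : ∀ x → x ≢ 0# → ∃ λ y → x * y ≡ 1#

HasOrder : Field → ℕ → Set
HasOrder F q = Field.Carrier F ↔ Fin q

module GraphG (F : Field) where
  open Field F

  Point : Set
  Point = Vec Carrier 4

  _⊕_ : Point → Point → Point
  _⊕_ = zipWith _+_

  _·_ : Carrier → Point → Point
  y · v = map (y *_) v

  v : Carrier → Point
  v z = 1# ∷ z ∷ (z * z) ∷ (z * z * z) ∷ []

  -- A line of L is presented by a direction parameter z and a base point x;
  -- it denotes the point set { x + y v_z : y ∈ F } ∈ 𝓛_z.
  record Line : Set where
    constructor line
    field
      dir  : Carrier
      base : Point

  _∈ₗ_ : Point → Line → Set
  p ∈ₗ line z x = ∃ λ y → p ≡ x ⊕ (y · v z)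

  -- Lines are compared as point sets (different presentations can give the
  -- same line).
  _≈ₗ_ : Line → Line → Set
  ℓ ≈ₗ ℓ' = ∀ p → (p ∈ₗ ℓ → p ∈ₗ ℓ') × (p ∈ₗ ℓ' → p ∈ₗ ℓ)

  direction : Line → Point
  direction ℓ = v (Line.dir ℓ)

  record Cycle8 (p₁ p₂ p₃ p₄ : Point) (ℓ₁ ℓ₂ ℓ₃ ℓ₄ : Line) : Set where
    field
      p₁≢p₂ : p₁ ≢ p₂
      p₁≢p₃ : p₁ ≢ p₃
      p₁≢p₄ : p₁ ≢ p₄
      p₂≢p₃ : p₂ ≢ p₃
      p₂≢p₄ : p₂ ≢ p₄
      p₃≢p₄ : p₃ ≢ p₄
      ℓ₁≉ℓ₂ : ¬ (ℓ₁ ≈ₗ ℓ₂)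
      ℓ₁≉ℓ₃ : ¬ (ℓ₁ ≈ₗ ℓ₃)
      ℓ₁≉ℓ₄ : ¬ (ℓ₁ ≈ₗ ℓ₄)
      ℓ₂≉ℓ₃ : ¬ (ℓ₂ ≈ₗ ℓ₃)
      ℓ₂≉ℓ₄ : ¬ (ℓ₂ ≈ₗ ℓ₄)
      ℓ₃≉ℓ₄ : ¬ (ℓ₃ ≈ₗ ℓ₄)
      p₁∈ℓ₁ : p₁ ∈ₗ ℓ₁
      p₂∈ℓ₁ : p₂ ∈ₗ ℓ₁
      p₂∈ℓ₂ : p₂ ∈ₗ ℓ₂
      p₃∈ℓ₂ : p₃ ∈ₗ ℓ₂
      p₃∈ℓ₃ : p₃ ∈ₗ ℓ₃
      p₄∈ℓ₃ : p₄ ∈ₗ ℓ₃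
      p₄∈ℓ₄ : p₄ ∈ₗ ℓ₄
      p₁∈ℓ₄ : p₁ ∈ₗ ℓ₄

module Submission where

-- Walking once around the cycle gives δ₁ v(z₁) + δ₂ v(z₂) + δ₃ v(z₃) + δ₄ v(z₄) = 0 with every
-- δᵢ ≠ 0, where zᵢ is the direction parameter of ℓᵢ; consecutive directions differ, since two
-- lines through a common point with the same direction coincide. Pairing the relation with the
-- coefficients of the cubic vanishing at z₂, z₃, z₄ kills every term except
-- δ₁ (z₁ - z₂)(z₁ - z₃)(z₁ - z₄), so z₁ = z₃; the cycle started at p₂ gives z₂ = z₄.

open import Defs
open import Data.Nat using (ℕ)
open import Data.Product using (_×_; _,_; ∃)
open import Data.Sum using (_⊎_; inj₁; inj₂)
open import Data.Vec using (Vec; []; _∷_; zipWith; map)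
open import Data.Vec.Properties using (∷-injectiveˡ; ∷-injectiveʳ)
import Data.Fin.Properties as Fin
open import Algebra.Bundles using (CommutativeRing)
open import Algebra.Structures using (IsCommutativeRing)
open import Function using (_∘_)
open import Function.Properties.Inverse using (↔⇒↣)
open import Relation.Binary.Definitions using (DecidableEquality)
open import Relation.Binary.PropositionalEquality
  using (_≡_; _≢_; refl; sym; trans; cong; cong₂; module ≡-Reasoning)
open import Relation.Nullary using (¬_)
open import Relation.Nullary.Decidable using (via-injection; decidable-stable)

finite⇒decidableEquality : ∀ {q} (F : Field) → HasOrder F q → DecidableEquality (Field.Carrier F)
finite⇒decidableEquality F order = via-injection (↔⇒↣ order) Fin._≟_

module FieldArithmetic (F : Field) where
  open Field F public
  open IsCommutativeRing isCommutativeRing public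
    using (+-identityʳ; -‿inverseʳ; *-assoc; *-comm; *-identityˡ; zeroˡ; zeroʳ)

  commutativeRing : CommutativeRing _ _
  commutativeRing = record { isCommutativeRing = isCommutativeRing }

  open CommutativeRing commutativeRing public using (_-_; commutativeSemiring)
  open import Algebra.Properties.Group (CommutativeRing.+-group commutativeRing) public
    using (\\-leftDividesˡ; x∙y⁻¹≈ε⇒x≈y; identityʳ-unique)

  x≢y⇒x-y≢0 : ∀ {x y} → x ≢ y → x - y ≢ 0#
  x≢y⇒x-y≢0 x≢y x-y≡0 = x≢y (x∙y⁻¹≈ε⇒x≈y _ _ x-y≡0)

  x≢0∧y≢0⇒x*y≢0 : ∀ {x y} → x ≢ 0# → y ≢ 0# → x * y ≢ 0#
  x≢0∧y≢0⇒x*y≢0 {x} {y} x≢0 y≢0 xy≡0 with inverse x x≢0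
  ... | x⁻¹ , xx⁻¹≡1 = y≢0 (begin
    y                ≡⟨ sym (*-identityˡ y) ⟩
    1# * y           ≡⟨ cong (_* y) (trans (sym xx⁻¹≡1) (*-comm x x⁻¹)) ⟩
    x⁻¹ * x * y      ≡⟨ *-assoc x⁻¹ x y ⟩
    x⁻¹ * (x * y)    ≡⟨ cong (x⁻¹ *_) xy≡0 ⟩
    x⁻¹ * 0#         ≡⟨ zeroʳ x⁻¹ ⟩
    0#               ∎)
    where open ≡-Reasoning

  open import Algebra.Solver.Ring.NaturalCoefficients.Default commutativeSemiring public

  x*y*z≡0 : ∀ {x y z} → x ≡ 0# ⊎ y ≡ 0# ⊎ z ≡ 0# → x * y * z ≡ 0#
  x*y*z≡0 {x} {y} {z} (inj₁ refl)        = trans (cong (_* z) (zeroˡ y)) (zeroˡ z)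
  x*y*z≡0 {x} {y} {z} (inj₂ (inj₁ refl)) = trans (cong (_* z) (zeroʳ x)) (zeroˡ z)
  x*y*z≡0 {x} {y} {z} (inj₂ (inj₂ refl)) = zeroʳ (x * y)

  telescope : ∀ {a₁ a₂ a₃ a₄} e₁ e₂ e₃ e₄ →
    a₂ ≡ a₁ + e₁ → a₃ ≡ a₂ + e₂ → a₄ ≡ a₃ + e₃ → a₁ ≡ a₄ + e₄ → e₁ + e₂ + e₃ + e₄ ≡ 0#
  telescope {a₁} e₁ e₂ e₃ e₄ refl refl refl closes =
    identityʳ-unique a₁ (e₁ + e₂ + e₃ + e₄) (trans (reassociate a₁ e₁ e₂ e₃ e₄) (sym closes))
    where
    reassociate : ∀ a e₁ e₂ e₃ e₄ → a + (e₁ + e₂ + e₃ + e₄) ≡ a + e₁ + e₂ + e₃ + e₄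
    reassociate = solve 5 (λ a e₁ e₂ e₃ e₄ →
      a :+ (e₁ :+ e₂ :+ e₃ :+ e₄) := a :+ e₁ :+ e₂ :+ e₃ :+ e₄) refl

module Lines (F : Field) where
  open FieldArithmetic F
  open GraphG F

  ⟪_,_⟫ : ∀ {n} → Vec Carrier n → Vec Carrier n → Carrier
  ⟪ [] , [] ⟫ = 0#
  ⟪ a ∷ f , x ∷ p ⟫ = a * x + ⟪ f , p ⟫

  ⟪⟫-linear : ∀ {n} (f x w : Vec Carrier n) s →
    ⟪ f , zipWith _+_ x (map (s *_) w) ⟫ ≡ ⟪ f , x ⟫ + s * ⟪ f , w ⟫
  ⟪⟫-linear [] [] [] s = sym (trans (cong (0# +_) (zeroʳ s)) (+-identityʳ 0#))
  ⟪⟫-linear (a ∷ f) (x ∷ p) (w ∷ q) s = begin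
    a * (x + s * w) + ⟪ f , zipWith _+_ p (map (s *_) q) ⟫ ≡⟨ cong (a * (x + s * w) +_) (⟪⟫-linear f p q s) ⟩
    a * (x + s * w) + (⟪ f , p ⟫ + s * ⟪ f , q ⟫)          ≡⟨ distribute a x s w ⟪ f , p ⟫ ⟪ f , q ⟫ ⟩
    (a * x + ⟪ f , p ⟫) + s * (a * w + ⟪ f , q ⟫)          ∎
    where
    open ≡-Reasoning
    distribute : ∀ a x s w m n → a * (x + s * w) + (m + s * n) ≡ (a * x + m) + s * (a * w + n)
    distribute = solve 6 (λ a x s w m n →
      a :* (x :+ s :* w) :+ (m :+ s :* n) := (a :* x :+ m) :+ s :* (a :* w :+ n)) refl

  ⊕-·-merge : ∀ {n} (x w : Vec Carrier n) a b →
    zipWith _+_ (zipWith _+_ x (map (a *_) w)) (map (b *_) w) ≡ zipWith _+_ x (map ((a + b) *_) w)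
  ⊕-·-merge [] [] a b = refl
  ⊕-·-merge (x ∷ p) (w ∷ q) a b = cong₂ _∷_ (merge x w a b) (⊕-·-merge p q a b)
    where
    merge : ∀ x w a b → x + a * w + b * w ≡ x + (a + b) * w
    merge = solve 4 (λ x w a b → x :+ a :* w :+ b :* w := x :+ (a :+ b) :* w) refl

  -- Roots enter negated, so that ⟪cubic,v⟫ is a semiring identity within reach of the solver.
  cubic : Carrier → Carrier → Carrier → Point
  cubic α β γ = α * β * γ ∷ (α * β + β * γ + γ * α) ∷ (α + β + γ) ∷ 1# ∷ []

  ⟪cubic,v⟫ : ∀ α β γ z → ⟪ cubic α β γ , v z ⟫ ≡ (z + α) * (z + β) * (z + γ)
  ⟪cubic,v⟫ = solve 4 (λ α β γ z →
    α :* β :* γ :* con 1 :+ ((α :* β :+ β :* γ :+ γ :* α) :* z :+ ((α :+ β :+ γ) :* (z :* z)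
      :+ (con 1 :* (z :* z :* z) :+ con 0)))
    := (z :+ α) :* (z :+ β) :* (z :+ γ)) refl

  translate : ∀ {x w p p' s s'} → p ≡ x ⊕ (s · w) → p' ≡ x ⊕ (s' · w) → p' ≡ p ⊕ ((- s + s') · w)
  translate {x} {w} {s = s} {s'} refl refl = begin
    x ⊕ (s' · w)                   ≡⟨ cong (λ t → x ⊕ (t · w)) (sym (\\-leftDividesˡ s s')) ⟩
    x ⊕ ((s + (- s + s')) · w)     ≡⟨ sym (⊕-·-merge x w s (- s + s')) ⟩
    (x ⊕ (s · w)) ⊕ ((- s + s') · w) ∎
    where open ≡-Reasoning

  common-point⇒⊆ : ∀ {p z x x'} r → p ∈ₗ line z x → p ∈ₗ line z x' → r ∈ₗ line z x → r ∈ₗ line z x'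
  common-point⇒⊆ {z = z} {x' = x'} r (s , p≡) (s' , refl) (t , r≡) =
    s' + (- s + t) , trans (translate p≡ r≡) (⊕-·-merge x' (v z) s' (- s + t))

  common-point⇒≈ₗ : ∀ {p z x x'} → p ∈ₗ line z x → p ∈ₗ line z x' → line z x ≈ₗ line z x'
  common-point⇒≈ₗ p∈ℓ p∈ℓ' r = common-point⇒⊆ r p∈ℓ p∈ℓ' , common-point⇒⊆ r p∈ℓ' p∈ℓ

  common-point⇒dir≢ : ∀ {p ℓ ℓ'} → p ∈ₗ ℓ → p ∈ₗ ℓ' → ¬ ℓ ≈ₗ ℓ' → Line.dir ℓ ≢ Line.dir ℓ'
  common-point⇒dir≢ p∈ℓ p∈ℓ' ℓ≉ℓ' refl = ℓ≉ℓ' (common-point⇒≈ₗ p∈ℓ p∈ℓ')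

  v-injective : ∀ {z z'} → v z ≡ v z' → z ≡ z'
  v-injective eq = ∷-injectiveˡ (∷-injectiveʳ eq)

  Step : Carrier → Point → Point → Set
  Step z p p' = ∃ λ δ → δ ≢ 0# × p' ≡ p ⊕ (δ · v z)

  distinct-collinear⇒Step : ∀ {p p' ℓ} → p ≢ p' → p ∈ₗ ℓ → p' ∈ₗ ℓ → Step (Line.dir ℓ) p p'
  distinct-collinear⇒Step {ℓ = ℓ} p≢p' (s , refl) (s' , refl) = - s + s' , δ≢0 , translate refl refl
    where
    δ≢0 : - s + s' ≢ 0#
    δ≢0 δ≡0 = p≢p' (cong (λ t → Line.base ℓ ⊕ (t · direction ℓ)) (begin
      s                ≡⟨ sym (+-identityʳ s) ⟩
      s + 0#           ≡⟨ cong (s +_) (sym δ≡0) ⟩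
      s + (- s + s')   ≡⟨ \\-leftDividesˡ s s' ⟩
      s'               ∎))
      where open ≡-Reasoning

  closed-walk-relation : ∀ {p₁ p₂ p₃ p₄ z₁ z₂ z₃ z₄ δ₁ δ₂ δ₃ δ₄} →
    p₂ ≡ p₁ ⊕ (δ₁ · v z₁) → p₃ ≡ p₂ ⊕ (δ₂ · v z₂) → p₄ ≡ p₃ ⊕ (δ₃ · v z₃) → p₁ ≡ p₄ ⊕ (δ₄ · v z₄) →
    ∀ f → δ₁ * ⟪ f , v z₁ ⟫ + δ₂ * ⟪ f , v z₂ ⟫ + δ₃ * ⟪ f , v z₃ ⟫ + δ₄ * ⟪ f , v z₄ ⟫ ≡ 0#
  closed-walk-relation e₁ e₂ e₃ e₄ f = telescope _ _ _ _ (pairing-step e₁) (pairing-step e₂) (pairing-step e₃) (pairing-step e₄)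
    where
    pairing-step : ∀ {p p' δ w} → p' ≡ p ⊕ (δ · w) → ⟪ f , p' ⟫ ≡ ⟪ f , p ⟫ + δ * ⟪ f , w ⟫
    pairing-step refl = ⟪⟫-linear f _ _ _

  closed-walk-opposite-dirs : ∀ {p₁ p₂ p₃ p₄ z₁ z₂ z₃ z₄} →
    Step z₁ p₁ p₂ → Step z₂ p₂ p₃ → Step z₃ p₃ p₄ → Step z₄ p₄ p₁ →
    z₁ ≢ z₂ → z₁ ≢ z₄ → ¬ z₁ ≢ z₃
  closed-walk-opposite-dirs {z₁ = z₁} {z₂} {z₃} {z₄}
    (δ₁ , δ₁≢0 , e₁) (δ₂ , _ , e₂) (δ₃ , _ , e₃) (δ₄ , _ , e₄) z₁≢z₂ z₁≢z₄ z₁≢z₃ =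
    x≢0∧y≢0⇒x*y≢0 δ₁≢0 g₁≢0 (begin
      δ₁ * g z₁                                       ≡⟨ +-identityʳ³ (δ₁ * g z₁) ⟨
      δ₁ * g z₁ + 0# + 0# + 0#                        ≡⟨ cong₂ _+_ (cong₂ _+_ (cong (δ₁ * g z₁ +_)
                                                             (vanish δ₂ g₂≡0)) (vanish δ₃ g₃≡0)) (vanish δ₄ g₄≡0) ⟨
      δ₁ * g z₁ + δ₂ * g z₂ + δ₃ * g z₃ + δ₄ * g z₄   ≡⟨ closed-walk-relation e₁ e₂ e₃ e₄ f ⟩
      0#                                              ∎)
    where
    open ≡-Reasoning
    f : Point
    f = cubic (- z₂) (- z₃) (- z₄)
    g : Carrier → Carrier
    g z = ⟪ f , v z ⟫
    g₁≢0 : g z₁ ≢ 0#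
    g₁≢0 rewrite ⟪cubic,v⟫ (- z₂) (- z₃) (- z₄) z₁ =
      x≢0∧y≢0⇒x*y≢0 (x≢0∧y≢0⇒x*y≢0 (x≢y⇒x-y≢0 z₁≢z₂) (x≢y⇒x-y≢0 z₁≢z₃)) (x≢y⇒x-y≢0 z₁≢z₄)
    g₂≡0 : g z₂ ≡ 0#
    g₂≡0 = trans (⟪cubic,v⟫ _ _ _ z₂) (x*y*z≡0 (inj₁ (-‿inverseʳ z₂)))
    g₃≡0 : g z₃ ≡ 0#
    g₃≡0 = trans (⟪cubic,v⟫ _ _ _ z₃) (x*y*z≡0 (inj₂ (inj₁ (-‿inverseʳ z₃))))
    g₄≡0 : g z₄ ≡ 0#
    g₄≡0 = trans (⟪cubic,v⟫ _ _ _ z₄) (x*y*z≡0 (inj₂ (inj₂ (-‿inverseʳ z₄))))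
    vanish : ∀ δ {x} → x ≡ 0# → δ * x ≡ 0#
    vanish δ refl = zeroʳ δ
    +-identityʳ³ : ∀ a → a + 0# + 0# + 0# ≡ a
    +-identityʳ³ = solve 1 (λ a → a :+ con 0 :+ con 0 :+ con 0 := a) refl

lemma4p2 : (q : ℕ) → IsPrimePower q → (F : Field) → HasOrder F q →
    let open GraphG F in
    (p₁ p₂ p₃ p₄ : Point) (ℓ₁ ℓ₂ ℓ₃ ℓ₄ : Line) →
    Cycle8 p₁ p₂ p₃ p₄ ℓ₁ ℓ₂ ℓ₃ ℓ₄ →
    (direction ℓ₁ ≡ direction ℓ₃) × (direction ℓ₂ ≡ direction ℓ₄) ×
    (direction ℓ₁ ≢ direction ℓ₂)
lemma4p2 q _ F order p₁ p₂ p₃ p₄ ℓ₁ ℓ₂ ℓ₃ ℓ₄ cycle =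
    cong v (decidable-stable (z₁ ≟ z₃) (closed-walk-opposite-dirs s₁ s₂ s₃ s₄ z₁≢z₂ z₁≢z₄))
  , cong v (decidable-stable (z₂ ≟ z₄) (closed-walk-opposite-dirs s₂ s₃ s₄ s₁ z₂≢z₃ (z₁≢z₂ ∘ sym)))
  , z₁≢z₂ ∘ v-injective
  where
  open GraphG F
  open Lines F
  open Field F using (Carrier)
  open Cycle8 cycle
  z₁ z₂ z₃ z₄ : Carrier
  z₁ = Line.dir ℓ₁
  z₂ = Line.dir ℓ₂
  z₃ = Line.dir ℓ₃
  z₄ = Line.dir ℓ₄
  _≟_ : DecidableEquality Carrier
  _≟_ = finite⇒decidableEquality F order
  s₁ : Step z₁ p₁ p₂
  s₁ = distinct-collinear⇒Step p₁≢p₂ p₁∈ℓ₁ p₂∈ℓ₁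
  s₂ : Step z₂ p₂ p₃
  s₂ = distinct-collinear⇒Step p₂≢p₃ p₂∈ℓ₂ p₃∈ℓ₂
  s₃ : Step z₃ p₃ p₄
  s₃ = distinct-collinear⇒Step p₃≢p₄ p₃∈ℓ₃ p₄∈ℓ₃
  s₄ : Step z₄ p₄ p₁
  s₄ = distinct-collinear⇒Step (p₁≢p₄ ∘ sym) p₄∈ℓ₄ p₁∈ℓ₄
  z₁≢z₂ : z₁ ≢ z₂
  z₁≢z₂ = common-point⇒dir≢ p₂∈ℓ₁ p₂∈ℓ₂ ℓ₁≉ℓ₂
  z₁≢z₄ : z₁ ≢ z₄
  z₁≢z₄ = common-point⇒dir≢ p₁∈ℓ₁ p₁∈ℓ₄ ℓ₁≉ℓ₄
  z₂≢z₃ : z₂ ≢ z₃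
  z₂≢z₃ = common-point⇒dir≢ p₃∈ℓ₂ p₃∈ℓ₃ ℓ₂≉ℓ₃
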